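{- Let $M$ be a matroid on a finite set $E$ with a fixed linear order. For any linear extension $\prec$ of $\le_{ext/int}$ restricted to the nbc sets of $M$, the corresponding shelling of $\Delta^{\mathrm{nbc}}_M$ has property (H): for every vertex $e$, every facet $F$ and every face $G\subseteq F$, if $e\in G$ and $e\in R(F)$ then $e\in R(G)$.
   Context: Activities: for $S\subseteq E$, $e\in E\setminus S$ is externally active w.r.t. $S$ if there is a circuit $\gamma\subseteq S\cup\{e\}$ of $M$ with $e=\max\gamma$; set $\operatorname{EA}(S)$. An element $i\in S$ is internally active w.r.t. $S$ if it is externally active w.r.t. $E\setminus S$ in the dual matroid $M^\perp$; set $\operatorname{IA}(S)$. Every independent set $I$ is uniquely $B_I\setminus Y$ with $B_I$ a basis and $Y\subseteq\operatorname{IA}(B_I)$; internally related = same related basis. nbc sets: independent sets $I$ with $\operatorname{EA}(I)=\emptyset$. Order: $I\le_{ext/int}J$ iff either $I,J$ not internally related and $(I\setminus\operatorname{IA}(I))\cup\operatorname{EA}(I)\subseteq(J\setminus\operatorname{IA}(J))\cup\operatorname{EA}(J)$, or internally related and $I\subseteq J$. $\Delta^{\mathrm{nbc}}_M$: vertices $\{y_e,z_e:e\in E\}$, facets $G(I)=\{y_e:e\in B_I\setminus I\}\cup\{z_e:e\in I\}$ for nbc sets $I$; linear extensions of $\le_{ext/int}$ on nbc sets order them as a shelling. Restriction sets: in a shelling $F_1,\dots,F_s$, $R_j$ is the unique subset of $F_j$ such that for $A\subseteq F_j$, $R_j\subseteq A$ iff $A\not\subseteq F_i$ for all $i<j$.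 Each face $G$ lies in exactly one interval $[R_i,F_i]$; put $R(G)=R_i$ (so $R(F_i)=R_i$). -}

module Defs where

open import Data.Nat using (ℕ; _<_)
open import Data.Fin using (Fin)
import Data.Fin as F
open import Data.Fin.Subset
open import Data.Product using (_×_; Σ; ∃; _,_; proj₁; proj₂)
open import Data.Sum using (_⊎_; inj₁; inj₂)
open import Relation.Nullary using (¬_)
open import Relation.Binary.PropositionalEquality using (_≡_)
open import Function.Definitions using (Injective)

-- A matroid on the ground set E = Fin n, given by its independent sets.
-- The fixed linear order on E is the usual order on Fin n.
record Matroid (n : ℕ) : Set₁ where
  field
    Indep      : Subset n → Set
    indep-∅    : Indep ⊥
    indep-⊆    : ∀ {I J} → J ⊆ I → Indep I → Indep J
    indep-aug  : ∀ {I J} → Indep I → Indep J → ∣ I ∣ < ∣ J ∣ →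
                 ∃ λ e → e ∈ J × e ∉ I × Indep (⁅ e ⁆ ∪ I)

module _ {n : ℕ} where

  IsBasis : (Subset n → Set) → Subset n → Set
  IsBasis Ind B = Ind B × (∀ J → Ind J → B ⊆ J → J ≡ B)

  IsCircuit : (Subset n → Set) → Subset n → Set
  IsCircuit Ind C = ¬ Ind C × (∀ D → D ⊂ C → Ind D)

  IsMax : Fin n → Subset n → Set
  IsMax e γ = e ∈ γ × (∀ x → x ∈ γ → x F.≤ e)

  ExtActiveFor : (Subset n → Set) → Subset n → Fin n → Set
  ExtActiveFor Ind S e =
    e ∉ S × ∃ λ γ → IsCircuit Ind γ × γ ⊆ S ∪ ⁅ e ⁆ × IsMax e γ

  DualIndep : Matroid n → Subset n → Set
  DualIndep M I = ∃ λ B → IsBasis (Matroid.Indep M) B × I ⊆ ∁ B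

  EA : Matroid n → Subset n → Fin n → Set
  EA M S e = ExtActiveFor (Matroid.Indep M) S e

  IA : Matroid n → Subset n → Fin n → Set
  IA M S i = i ∈ S × ExtActiveFor (DualIndep M) (∁ S) i

  NBC : Matroid n → Subset n → Set
  NBC M I = Matroid.Indep M I × (∀ e → ¬ EA M I e)

  RelBasis : Matroid n → Subset n → Subset n → Set
  RelBasis M I B = IsBasis (Matroid.Indep M) B × I ⊆ B ×
                   (∀ e → e ∈ B → e ∉ I → IA M B e)

  InternallyRelated : Matroid n → Subset n → Subset n → Set
  InternallyRelated M I J = ∃ λ B → RelBasis M I B × RelBasis M J B

  Core : Matroid n → Subset n → Fin n → Set
  Core M I e = (e ∈ I × ¬ IA M I e) ⊎ EA M I e

  _≤ei[_]_ : Subset n → Matroid n → Subset n → Set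
  I ≤ei[ M ] J =
    (¬ InternallyRelated M I J × (∀ e → Core M I e → Core M J e))
    ⊎ (InternallyRelated M I J × I ⊆ J)

  -- ord : Fin s → Subset n enumerates the nbc sets in the order of a
  -- linear extension of ≤_{ext/int} restricted to nbc sets
  IsNBCLinExt : Matroid n → (s : ℕ) → (Fin s → Subset n) → Set
  IsNBCLinExt M s ord =
    Injective _≡_ _≡_ ord ×
    (∀ k → NBC M (ord k)) ×
    (∀ I → NBC M I → ∃ λ k → ord k ≡ I) ×
    (∀ k l → ord k ≤ei[ M ] ord l → k F.≤ l)

  -- Vertices of Δ^nbc_M: inj₁ e = y_e, inj₂ e = z_e.
  Vertex : Set
  Vertex = Fin n ⊎ Fin n

  -- A set of vertices: (set of e with y_e, set of e with z_e)
  VSet : Set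
  VSet = Subset n × Subset n

  _∈V_ : Vertex → VSet → Set
  inj₁ e ∈V A = e ∈ proj₁ A
  inj₂ e ∈V A = e ∈ proj₂ A

  _⊆V_ : VSet → VSet → Set
  A ⊆V B = ∀ v → v ∈V A → v ∈V B

  -- facet G(I) = {y_e : e ∈ B_I ∖ I} ∪ {z_e : e ∈ I}, given B = B_I
  facetG : Subset n → Subset n → VSet
  facetG B I = (B ─ I , I)

  IsRestriction : {s : ℕ} → (Fin s → VSet) → Fin s → VSet → Set
  IsRestriction {s} Fc j R =
    R ⊆V Fc j ×
    (∀ A → A ⊆V Fc j →
       (R ⊆V A → ∀ i → i F.< j → ¬ (A ⊆V Fc i)) ×
       ((∀ i → i F.< j → ¬ (A ⊆V Fc i)) → R ⊆V A))

-- The restriction set of the facet G(I) is exactly {z_e : e ∈ I}.  Removing a vertex y_x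
-- from G(I) leaves a face with z-part I, which lies only in facets G(J) with I ⊆ J, and
-- these come after G(I) since I ≤ext/int J.  Removing z_x leaves a face inside G(I ∖ x),
-- which comes before G(I); the matroid input is B_I ∖ I ⊆ B_(I ∖ x), proved with the
-- cocircuits that witness internal activity.
module Submission where

open import Defs
open import Data.Nat using (ℕ; _≤_; _<_; suc; zero; _+_)
open import Data.Nat.Properties using (≮⇒≥; <⇒≱; ≤-trans; _<?_; +-suc; +-monoʳ-≤; m≤m+n)
open import Data.Fin using (Fin)
import Data.Fin as Fin
open import Data.Fin.Properties using (≤∧≢⇒<; <-asym)
open import Data.Fin.Subset using (Subset; _∈_; _∉_; _⊆_; _∪_; _─_; _-_; ⁅_⁆; ∁; ∣_∣; outside)
open import Data.Fin.Subset.Properties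
open import Data.Vec using (_∷_; here; there)
open import Data.Product using (∃; _×_; _,_; proj₁; proj₂)
open import Data.Sum using (inj₁; inj₂)
open import Data.Empty using (⊥-elim)
open import Function using (_∘_; id)
open import Relation.Nullary using (¬_; yes; no; contradiction)
open import Relation.Binary.PropositionalEquality using (_≡_; _≢_; refl; sym; subst)

x∈p─q⇒x∉q : ∀ {n} (p q : Subset n) {x} → x ∈ p ─ q → x ∉ q
x∈p─q⇒x∉q (_ ∷ p) (outside ∷ q) here          ()
x∈p─q⇒x∉q (_ ∷ p) (_       ∷ q) (there x∈p─q) (there x∈q) = x∈p─q⇒x∉q p q x∈p─q x∈q

x∈∁p∪⁅y⁆∧x∈p⇒x≡y : ∀ {n} {p : Subset n} {x y} → x ∈ ∁ p ∪ ⁅ y ⁆ → x ∈ p → x ≡ y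
x∈∁p∪⁅y⁆∧x∈p⇒x≡y {p = p} {y = y} x∈∁p∪⁅y⁆ x∈p with x∈p∪q⁻ (∁ p) ⁅ y ⁆ x∈∁p∪⁅y⁆
... | inj₁ x∈∁p  = contradiction x∈p (x∈∁p⇒x∉p x∈∁p)
... | inj₂ x∈⁅y⁆ = x∈⁅y⁆⇒x≡y y x∈⁅y⁆

∪-monoˡ-⊆ : ∀ {n} {p q : Subset n} (r : Subset n) → p ⊆ q → p ∪ r ⊆ q ∪ r
∪-monoˡ-⊆ {p = p} r p⊆q x∈p∪r with x∈p∪q⁻ p r x∈p∪r
... | inj₁ x∈p = x∈p∪q⁺ (inj₁ (p⊆q x∈p))
... | inj₂ x∈r = x∈p∪q⁺ (inj₂ x∈r)

x∉p⇒∣p∣<∣⁅x⁆∪p∣ : ∀ {n} {p : Subset n} {x} → x ∉ p → ∣ p ∣ < ∣ ⁅ x ⁆ ∪ p ∣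
x∉p⇒∣p∣<∣⁅x⁆∪p∣ {p = p} {x} x∉p =
  p⊂q⇒∣p∣<∣q∣ (q⊆p∪q ⁅ x ⁆ p , x , x∈p∪q⁺ (inj₁ (x∈⁅x⁆ x)) , x∉p)

module MatroidFacts {n : ℕ} (M : Matroid n) where
  open Matroid M

  Basis : Subset n → Set
  Basis = IsBasis Indep

  basis-maximal-size : ∀ {B J} → Basis B → Indep J → ∣ J ∣ ≤ ∣ B ∣
  basis-maximal-size {B} (iB , B-maximal) iJ = ≮⇒≥ λ ∣B∣<∣J∣ →
    let e , _ , e∉B , iB+e = indep-aug iB iJ ∣B∣<∣J∣
    in e∉B (subst (e ∈_) (B-maximal _ iB+e (q⊆p∪q ⁅ e ⁆ B)) (x∈p∪q⁺ (inj₁ (x∈⁅x⁆ e))))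

  indep-of-basis-size⇒basis : ∀ {B J} → Basis B → Indep J → ∣ B ∣ ≤ ∣ J ∣ → Basis J
  indep-of-basis-size⇒basis {B} {J} bB iJ ∣B∣≤∣J∣ = iJ , λ K iK J⊆K → ⊆-antisym (K⊆J iK J⊆K) J⊆K
    where
    K⊆J : ∀ {K} → Indep K → J ⊆ K → K ⊆ J
    K⊆J {K} iK J⊆K {x} x∈K with x ∈? J
    ... | yes x∈J = x∈J
    ... | no  x∉J = contradiction (≤-trans (basis-maximal-size bB iK) ∣B∣≤∣J∣)
                                  (<⇒≱ (p⊂q⇒∣p∣<∣q∣ (J⊆K , x , x∈K , x∉J)))

  augment : ∀ k {J X} → Indep J → Indep X → ∣ X ∣ ≤ k + ∣ J ∣ →
            ∃ λ J' → J ⊆ J' × J' ⊆ J ∪ X × Indep J' × ∣ X ∣ ≤ ∣ J' ∣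
  augment k {J} {X} iJ iX bound with ∣ J ∣ <? ∣ X ∣
  ... | no ∣J∣≮∣X∣ = J , id , p⊆p∪q X , iJ , ≮⇒≥ ∣J∣≮∣X∣
  augment zero iJ iX bound | yes ∣J∣<∣X∣ = contradiction bound (<⇒≱ ∣J∣<∣X∣)
  augment (suc k) {J} {X} iJ iX bound | yes ∣J∣<∣X∣ with indep-aug iJ iX ∣J∣<∣X∣
  ... | e , e∈X , e∉J , iJ+e
      with augment k iJ+e iX
             (≤-trans bound (subst (_≤ k + ∣ ⁅ e ⁆ ∪ J ∣) (+-suc k ∣ J ∣)
                                   (+-monoʳ-≤ k (x∉p⇒∣p∣<∣⁅x⁆∪p∣ e∉J))))
  ...   | J' , J+e⊆J' , J'⊆J+e∪X , iJ' , ∣X∣≤∣J'∣ =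
          J' , J+e⊆J' ∘ q⊆p∪q ⁅ e ⁆ J , J'⊆J∪X , iJ' , ∣X∣≤∣J'∣
    where
    J'⊆J∪X : J' ⊆ J ∪ X
    J'⊆J∪X y∈J' with x∈p∪q⁻ (⁅ e ⁆ ∪ J) X (J'⊆J+e∪X y∈J')
    ... | inj₂ y∈X = x∈p∪q⁺ (inj₂ y∈X)
    ... | inj₁ y∈J+e with x∈p∪q⁻ ⁅ e ⁆ J y∈J+e
    ...   | inj₁ y∈⁅e⁆ = x∈p∪q⁺ (inj₂ (subst (_∈ X) (sym (x∈⁅y⁆⇒x≡y e y∈⁅e⁆)) e∈X))
    ...   | inj₂ y∈J   = x∈p∪q⁺ (inj₁ y∈J)

  extend-to-basis : ∀ {B J} → Basis B → Indep J → ∃ λ J' → J ⊆ J' × J' ⊆ J ∪ B × Basis J'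
  extend-to-basis {B} {J} bB iJ =
    let J' , J⊆J' , J'⊆J∪B , iJ' , ∣B∣≤∣J'∣ = augment ∣ B ∣ iJ (proj₁ bB) (m≤m+n ∣ B ∣ ∣ J ∣)
    in J' , J⊆J' , J'⊆J∪B , indep-of-basis-size⇒basis bB iJ' ∣B∣≤∣J'∣

  cocircuit-meets-basis : ∀ {γ J} → IsCircuit (DualIndep M) γ → Basis J → ¬ (γ ⊆ ∁ J)
  cocircuit-meets-basis (γ-dual-dependent , _) bJ γ⊆∁J = γ-dual-dependent (_ , bJ , γ⊆∁J)

  IA-exchange-< : ∀ {B b J e} → IA M B b → Basis J →
                  (∀ {d} → d ∈ J → d ∉ B → d ≡ e) → b ∉ J → e Fin.< b
  IA-exchange-< {B} {b} {J} {e} (b∈B , _ , γ , cocircuit , γ⊆∁B+b , _ , b-max) bJ J∖B⊆e b∉J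
    with e Fin.<? b
  ... | yes e<b = e<b
  ... | no  e≮b = ⊥-elim (cocircuit-meets-basis cocircuit bJ (x∉p⇒x∈∁p ∘ γ∩J-empty))
    where
    γ∩J-empty : ∀ {d} → d ∈ γ → d ∉ J
    γ∩J-empty {d} d∈γ d∈J with d ∈? B
    ... | yes d∈B with x∈∁p∪⁅y⁆∧x∈p⇒x≡y (γ⊆∁B+b d∈γ) d∈B
    ...   | refl = b∉J d∈J
    γ∩J-empty {d} d∈γ d∈J | no d∉B with J∖B⊆e d∈J d∉B
    ...   | refl = e≮b (≤∧≢⇒< (b-max d d∈γ) λ { refl → d∉B b∈B })

  -- The cocircuit γ witnessing v ∈ IA(B) meets B only in v.  If v ∉ B', then W = (B' ∖ γ) ∪ {v}
  -- can be neither independent (a basis through W would have to contain B', using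
  -- IA-exchange-< against the maximality of v in γ) nor dependent (a basis through B' ∖ γ
  -- inside (B' ∖ γ) ∪ B would miss γ).
  IA⊆basis-with-active-surplus : ∀ {B B' v} → Basis B → Basis B' →
                                 (∀ s → s ∈ B' → s ∉ B → IA M B' s) → IA M B v → v ∈ B'
  IA⊆basis-with-active-surplus {B} {B'} {v} bB bB' surplus-active
                               (_ , _ , γ , cocircuit , γ⊆∁B+v , _ , v-max) with v ∈? B'
  ... | yes v∈B' = v∈B'
  ... | no  v∉B' = ⊥-elim (W-not-dependent W-not-independent)
    where
    W : Subset n
    W = (B' ─ γ) ∪ ⁅ v ⁆

    γ∩B⊆v : ∀ {d} → d ∈ γ → d ∈ B → d ≡ v
    γ∩B⊆v d∈γ = x∈∁p∪⁅y⁆∧x∈p⇒x≡y (γ⊆∁B+v d∈γ)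

    W-not-independent : ¬ Indep W
    W-not-independent iW with extend-to-basis bB' iW
    ... | J , W⊆J , J⊆W∪B' , bJ = v∉B' (subst (v ∈_) J≡B' (W⊆J (q⊆p∪q (B' ─ γ) ⁅ v ⁆ (x∈⁅x⁆ v))))
      where
      J∖B'⊆v : ∀ {d} → d ∈ J → d ∉ B' → d ≡ v
      J∖B'⊆v {d} d∈J d∉B' with x∈p∪q⁻ W B' (J⊆W∪B' d∈J)
      ... | inj₂ d∈B' = contradiction d∈B' d∉B'
      ... | inj₁ d∈W with x∈p∪q⁻ (B' ─ γ) ⁅ v ⁆ d∈W
      ...   | inj₁ d∈B'─γ = contradiction (p─q⊆p B' γ d∈B'─γ) d∉B'
      ...   | inj₂ d∈⁅v⁆ = x∈⁅y⁆⇒x≡y v d∈⁅v⁆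

      B'⊆J : B' ⊆ J
      B'⊆J {s} s∈B' with s ∈? J | s ∈? γ
      ... | yes s∈J | _       = s∈J
      ... | no  s∉J | no s∉γ  = contradiction (W⊆J (p⊆p∪q ⁅ v ⁆ (x∈p∧x∉q⇒x∈p─q s∈B' s∉γ))) s∉J
      ... | no  s∉J | yes s∈γ =
            ⊥-elim (<-asym (≤∧≢⇒< (v-max s s∈γ) s≢v)
                           (IA-exchange-< (surplus-active s s∈B' s∉B) bJ J∖B'⊆v s∉J))
        where
        s≢v : s ≢ v
        s≢v refl = v∉B' s∈B'
        s∉B : s ∉ B
        s∉B = s≢v ∘ γ∩B⊆v s∈γ

      J≡B' : J ≡ B'
      J≡B' = proj₂ bB' J (proj₁ bJ) B'⊆J

    W-not-dependent : ¬ ¬ Indep W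
    W-not-dependent W-dependent
      with extend-to-basis bB (indep-⊆ (p─q⊆p B' γ) (proj₁ bB'))
    ... | J , B'─γ⊆J , J⊆B'─γ∪B , bJ = cocircuit-meets-basis cocircuit bJ (x∉p⇒x∈∁p ∘ γ∩J-empty)
      where
      v∉J : v ∉ J
      v∉J v∈J = W-dependent (indep-⊆ W⊆J (proj₁ bJ))
        where
        W⊆J : W ⊆ J
        W⊆J y∈W with x∈p∪q⁻ (B' ─ γ) ⁅ v ⁆ y∈W
        ... | inj₁ y∈B'─γ = B'─γ⊆J y∈B'─γ
        ... | inj₂ y∈⁅v⁆  = subst (_∈ J) (sym (x∈⁅y⁆⇒x≡y v y∈⁅v⁆)) v∈J

      γ∩J-empty : ∀ {d} → d ∈ γ → d ∉ J
      γ∩J-empty {d} d∈γ d∈J with x∈p∪q⁻ (B' ─ γ) B (J⊆B'─γ∪B d∈J)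
      ... | inj₁ d∈B'─γ = x∈p─q⇒x∉q B' γ d∈B'─γ d∈γ
      ... | inj₂ d∈B with γ∩B⊆v d∈γ d∈B
      ...   | refl = v∉J d∈J

  removed⊆relBasis : ∀ {I K B B'} → RelBasis M I B → RelBasis M K B' → K ⊆ I → B ─ I ⊆ B'
  removed⊆relBasis {I} {B = B} (bB , I⊆B , removed-active) (bB' , _ , removed-active') K⊆I {v} v∈B─I =
    IA⊆basis-with-active-surplus bB bB'
      (λ s s∈B' s∉B → removed-active' s s∈B' (s∉B ∘ I⊆B ∘ K⊆I))
      (removed-active v (p─q⊆p B I v∈B─I) (x∈p─q⇒x∉q B I v∈B─I))

  IA-antitone : ∀ {I K e} → I ⊆ K → e ∈ I → IA M K e → IA M I e
  IA-antitone {e = e} I⊆K e∈I (_ , _ , γ , cocircuit , γ⊆∁K+e , e-max) =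
    e∈I , x∈p⇒x∉∁p e∈I , γ , cocircuit , ∪-monoˡ-⊆ ⁅ e ⁆ (p⊆q⇒∁p⊇∁q I⊆K) ∘ γ⊆∁K+e , e-max

  NBC-⊆ : ∀ {I K} → K ⊆ I → NBC M I → NBC M K
  NBC-⊆ {I} {K} K⊆I (iI , I-no-EA) = indep-⊆ K⊆I iI , K-no-EA
    where
    K-no-EA : ∀ e → ¬ EA M K e
    K-no-EA e (_ , γ , circuit , γ⊆K+e , e-max) with e ∈? I
    ... | yes e∈I = proj₁ circuit (indep-⊆ γ⊆I iI)
      where
      γ⊆I : γ ⊆ I
      γ⊆I d∈γ with x∈p∪q⁻ K ⁅ e ⁆ (γ⊆K+e d∈γ)
      ... | inj₁ d∈K   = K⊆I d∈K
      ... | inj₂ d∈⁅e⁆ = subst (_∈ I) (sym (x∈⁅y⁆⇒x≡y e d∈⁅e⁆)) e∈I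
    ... | no e∉I = I-no-EA e (e∉I , γ , circuit , ∪-monoˡ-⊆ ⁅ e ⁆ K⊆I ∘ γ⊆K+e , e-max)

  -- Internal relatedness is not decidable here, so only the double negation is available.
  NBC-⊆⇒≤ei : ∀ {I K} → NBC M I → I ⊆ K → ¬ ¬ (I ≤ei[ M ] K)
  NBC-⊆⇒≤ei {I} {K} (_ , I-no-EA) I⊆K I≰K =
    (λ unrelated → I≰K (inj₁ (unrelated , Core-mono))) (λ related → I≰K (inj₂ (related , I⊆K)))
    where
    Core-mono : ∀ e → Core M I e → Core M K e
    Core-mono e (inj₁ (e∈I , e∉IA)) = inj₁ (I⊆K e∈I , e∉IA ∘ IA-antitone I⊆K e∈I)
    Core-mono e (inj₂ e∈EA)        = contradiction e∈EA (I-no-EA e)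

module NBCShelling {n : ℕ} (M : Matroid n) {s : ℕ} (ord rb : Fin s → Subset n)
                   (lin-ext : IsNBCLinExt M s ord)
                   (rel-basis : ∀ k → RelBasis M (ord k) (rb k)) where
  open MatroidFacts M

  F : Fin s → VSet
  F k = facetG (rb k) (ord k)

  nbc : ∀ k → NBC M (ord k)
  nbc = proj₁ (proj₂ lin-ext)

  index : ∀ {I} → NBC M I → ∃ λ k → ord k ≡ I
  index = proj₁ (proj₂ (proj₂ lin-ext)) _

  order-preserving : ∀ k l → ord k ≤ei[ M ] ord l → k Fin.≤ l
  order-preserving = proj₂ (proj₂ (proj₂ lin-ext))

  later-not-⊆-earlier : ∀ {j k} → k Fin.< j → ¬ (ord j ⊆ ord k)
  later-not-⊆-earlier {j} {k} k<j Ij⊆Ik =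
    NBC-⊆⇒≤ei (nbc j) Ij⊆Ik (<⇒≱ k<j ∘ order-preserving j k)

  restriction-has-no-y : ∀ {j R x} → IsRestriction F j R → ¬ (inj₁ x ∈V R)
  restriction-has-no-y {j} {x = x} (_ , restricted) y∈R =
    x∈p─q⇒x∉q (rb j ─ ord j) ⁅ x ⁆ (proj₂ (restricted A A⊆Fj) A-new (inj₁ x) y∈R) (x∈⁅x⁆ x)
    where
    A : VSet
    A = (rb j ─ ord j - x , ord j)

    A⊆Fj : A ⊆V F j
    A⊆Fj (inj₁ v) = p─q⊆p (rb j ─ ord j) ⁅ x ⁆
    A⊆Fj (inj₂ v) = id

    A-new : ∀ k → k Fin.< j → ¬ (A ⊆V F k)
    A-new k k<j A⊆Fk = later-not-⊆-earlier k<j (λ {v} → A⊆Fk (inj₂ v))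

  restriction-has-z : ∀ {i R x} → IsRestriction F i R → x ∈ ord i → inj₂ x ∈V R
  restriction-has-z {i} {R} {x} (R⊆Fi , restricted) x∈I with x ∈? proj₂ R
  ... | yes z∈R = z∈R
  ... | no  z∉R = ⊥-elim (NBC-⊆⇒≤ei (nbc k) Ik⊆I Ik≰I)
    where
    I : Subset n
    I = ord i

    A : VSet
    A = (rb i ─ I , I - x)

    A⊆Fi : A ⊆V F i
    A⊆Fi (inj₁ v) = id
    A⊆Fi (inj₂ v) = p─q⊆p I ⁅ x ⁆

    R⊆A : R ⊆V A
    R⊆A (inj₁ v) v∈R = R⊆Fi (inj₁ v) v∈R
    R⊆A (inj₂ v) v∈R = x∈p∧x≢y⇒x∈p-y (R⊆Fi (inj₂ v) v∈R) λ { refl → z∉R v∈R }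

    I-x-indexed : ∃ λ k → ord k ≡ I - x
    I-x-indexed = index (NBC-⊆ (p─q⊆p I ⁅ x ⁆) (nbc i))

    k : Fin s
    k = proj₁ I-x-indexed

    Ik≡I-x : ord k ≡ I - x
    Ik≡I-x = proj₂ I-x-indexed

    Ik⊆I : ord k ⊆ I
    Ik⊆I = p─q⊆p I ⁅ x ⁆ ∘ subst (_ ∈_) Ik≡I-x

    A⊆Fk : A ⊆V F k
    A⊆Fk (inj₁ v) v∈B─I = x∈p∧x∉q⇒x∈p─q (removed⊆relBasis (rel-basis i) (rel-basis k) Ik⊆I v∈B─I)
                                         (x∈p─q⇒x∉q (rb i) I v∈B─I ∘ Ik⊆I)
    A⊆Fk (inj₂ v) = subst (v ∈_) (sym Ik≡I-x)

    k≢i : k ≢ i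
    k≢i k≡i = x∈p─q⇒x∉q I ⁅ x ⁆ (subst (x ∈_) Ik≡I-x (subst (λ l → x ∈ ord l) (sym k≡i) x∈I)) (x∈⁅x⁆ x)

    Ik≰I : ¬ (ord k ≤ei[ M ] I)
    Ik≰I Ik≤I = proj₁ (restricted A A⊆Fi) R⊆A k (≤∧≢⇒< (order-preserving k i Ik≤I) k≢i) A⊆Fk

corollary7p6 : ∀ {n : ℕ} (M : Matroid n) (s : ℕ) (ord : Fin s → Subset n)
    (rb : Fin s → Subset n) →
    IsNBCLinExt M s ord →
    (∀ k → RelBasis M (ord k) (rb k)) →
    ∀ (e : Vertex) (j : Fin s) (RF : VSet) →
    IsRestriction (λ k → facetG (rb k) (ord k)) j RF →
    ∀ (G : VSet) → G ⊆V facetG (rb j) (ord j) →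
    e ∈V G → e ∈V RF →
    ∀ (i : Fin s) (RG : VSet) →
    IsRestriction (λ k → facetG (rb k) (ord k)) i RG →
    RG ⊆V G → G ⊆V facetG (rb i) (ord i) →
    e ∈V RG
corollary7p6 M s ord rb lin-ext rel-basis (inj₁ x) _ _ RF-restriction _ _ _ y∈RF _ _ _ _ _ =
  ⊥-elim (restriction-has-no-y RF-restriction y∈RF)
  where open NBCShelling M ord rb lin-ext rel-basis
corollary7p6 M s ord rb lin-ext rel-basis (inj₂ x) _ _ _ _ _ z∈G _ _ _ RG-restriction _ G⊆Fi =
  restriction-has-z RG-restriction (G⊆Fi (inj₂ x) z∈G)
  where open NBCShelling M ord rb lin-ext rel-basis
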